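{- Let $G$ be a dynamic graph on $n$ vertices whose arboricity is at most $\alpha$, and consider the Brodal–Fagerberg algorithm with threshold $\Delta$ modified so that in every reset cascade the next vertex to be reset is always one of largest outdegree among the vertices with outdegree greater than $\Delta$. Then during any reset cascade (following an edge insertion into a graph with a $\Delta$-orientation), the outdegree of every vertex never exceeds $4\alpha\lceil\log_2(n/\alpha)\rceil+\Delta$.
   Context: Arboricity of $G=(V,E)$: $\max_{U\subseteq V,|U|\ge2}\lceil |E(U)|/(|U|-1)\rceil$. A $\Delta$-orientation is an orientation of the edges with every outdegree at most $\Delta$. Resetting a vertex means flipping all its outgoing edges so they become incoming. The Brodal–Fagerberg (BF) algorithm with threshold $\Delta$: a deletion removes the edge; an inserted edge is oriented; then, as long as some vertex has outdegree greater than $\Delta$, such a vertex is reset (the reset cascade). -}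

module Defs where

open import Data.Nat using (ℕ; zero; suc; _+_; _*_; _∸_; _^_; _≤_; _<_; _/_)
open import Data.Bool using (Bool; true; false; _∧_; _∨_; if_then_else_)
open import Data.Fin using (Fin; zero; suc; _≟_)
open import Data.Product using (_×_)
open import Relation.Nullary using (¬_; does)
open import Relation.Binary.PropositionalEquality using (_≡_)
open import Relation.Binary.Construct.Closure.ReflexiveTransitive using (Star)

count : ∀ {n} → (Fin n → Bool) → ℕ
count {zero}  p = 0
count {suc n} p = (if p zero then 1 else 0) + count (λ i → p (suc i))

sumFin : ∀ {n} → (Fin n → ℕ) → ℕ
sumFin {zero}  f = 0
sumFin {suc n} f = f zero + sumFin (λ i → f (suc i))

-- An orientation of a graph on vertex set Fin n: D u v ≡ true iff the edge {u,v}
-- is present and oriented u → v.  The underlying (undirected) graph is determined by D.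
Orientation : ℕ → Set
Orientation n = Fin n → Fin n → Bool

WellFormed : ∀ {n} → Orientation n → Set
WellFormed D = (∀ u → D u u ≡ false) × (∀ u v → D u v ≡ true → D v u ≡ false)

outdeg : ∀ {n} → Orientation n → Fin n → ℕ
outdeg D u = count (D u)

IsΔOrientation : ∀ {n} → ℕ → Orientation n → Set
IsΔOrientation Δ D = ∀ u → outdeg D u ≤ Δ

Subset : ℕ → Set
Subset n = Fin n → Bool

size : ∀ {n} → Subset n → ℕ
size U = count U

inducedEdges : ∀ {n} → Orientation n → Subset n → ℕ
inducedEdges D U = sumFin (λ u → count (λ v → U u ∧ U v ∧ D u v))

-- ceilDiv a b = ⌈ a / b ⌉ for b ≥ 1 (the value at b = 0 is irrelevant).
ceilDiv : ℕ → ℕ → ℕ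
ceilDiv a zero    = 0
ceilDiv a (suc b) = (a + b) / suc b

ArboricityAtMost : ∀ {n} → Orientation n → ℕ → Set
ArboricityAtMost {n} D α =
  (U : Subset n) → 2 ≤ size U → ceilDiv (inducedEdges D U) (size U ∸ 1) ≤ α

insertEdge : ∀ {n} → Orientation n → Fin n → Fin n → Orientation n
insertEdge D x y a b = (does (a ≟ x) ∧ does (b ≟ y)) ∨ D a b

-- Resetting v: all outgoing edges of v are flipped to become incoming.
reset : ∀ {n} → Orientation n → Fin n → Orientation n
reset D v a b =
  if does (a ≟ v) then false
  else (D a b ∨ (does (b ≟ v) ∧ D v a))

data CascadeStep {n : ℕ} (Δ : ℕ) : Orientation n → Orientation n → Set where
  step : (D : Orientation n) (v : Fin n) →
         Δ < outdeg D v →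
         (∀ w → Δ < outdeg D w → outdeg D w ≤ outdeg D v) →
         CascadeStep Δ D (reset D v)

CascadeReach : ∀ {n} → ℕ → Orientation n → Orientation n → Set
CascadeReach Δ = Star (CascadeStep Δ)

-- k = ⌈ log₂ (n / α) ⌉ (as a natural number): least k with n ≤ α · 2^k.
IsCeilLog2Ratio : ℕ → ℕ → ℕ → Set
IsCeilLog2Ratio n α k = (n ≤ α * 2 ^ k) × (∀ j → n ≤ α * 2 ^ j → k ≤ j)

module Submission where

-- For a level L ≥ Δ, the onset of L is the
-- first time from which, until the end, some outdegree always exceeds L; at
-- the onset every outdegree is at most L + 1.  A vertex is L-active if its
-- outdegree exceeds L at some time after the onset.  Largest-first pivoting
-- makes every later pivot L-active, so edges towards non-active vertices are
-- never flipped after the onset, and an outdegree above L + d forces d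
-- active neighbours.  In a graph of arboricity α, a set each of whose members
-- has 4α neighbours in U contains at most half of U (handshake lemma), so the
-- number of active vertices at least doubles each time the level drops by 4α.
-- A vertex of outdegree above 4αk + Δ would therefore make more than α·2ᵏ ≥ n
-- vertices Δ-active.

open import Defs
open import Data.Nat using (ℕ; zero; suc; _+_; _*_; _∸_; _^_; _≤_; _<_; _≤?_; _<?_; _/_; z≤n; s≤s)
open import Data.Nat.Properties hiding (_≟_)
open import Data.Nat.DivMod using (m*n/n≡m; /-monoˡ-≤)
open import Data.Nat.Tactic.RingSolver using (solve-∀)
open import Data.Fin using (Fin; zero; suc; _≟_)
open import Data.Fin.Properties using (all?; ¬∀⟶∃¬)
open import Data.Bool using (Bool; true; false; _∧_; _∨_; not; if_then_else_)
open import Data.Bool.Properties using (∨-zeroʳ; ∧-assoc; ∧-comm; ∧-distribˡ-∨; ∧-conicalˡ; ∧-conicalʳ)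
open import Data.Empty using (⊥-elim)
open import Data.Product using (∃; _×_; _,_)
open import Data.Sum using (_⊎_; inj₁; inj₂)
open import Relation.Nullary using (¬_; Dec; yes; no; does; contradiction)
open import Relation.Nullary.Decidable using (dec-true; _×-dec_)
open import Relation.Binary.PropositionalEquality
open import Relation.Binary.Construct.Closure.ReflexiveTransitive using (ε; _◅_)

false≢true : false ≢ true
false≢true ()

does-sound : ∀ {a} {A : Set a} (a? : Dec A) → does a? ≡ true → A
does-sound (yes a) _  = a
does-sound (no _)  ()

∨-true : ∀ x {y} → x ∨ y ≡ true → x ≡ true ⊎ y ≡ true
∨-true true  _ = inj₁ refl
∨-true false h = inj₂ h

∨-introˡ : ∀ {x} y → x ≡ true → x ∨ y ≡ true
∨-introˡ y refl = refl

∨-introʳ : ∀ x {y} → y ≡ true → x ∨ y ≡ true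
∨-introʳ x refl = ∨-zeroʳ x

∧-intro : ∀ {x y} → x ≡ true → y ≡ true → x ∧ y ≡ true
∧-intro refl h = h

∧-swap : ∀ x y z → x ∧ (y ∧ z) ≡ y ∧ (x ∧ z)
∧-swap x y z = begin
  x ∧ (y ∧ z)  ≡⟨ sym (∧-assoc x y z) ⟩
  (x ∧ y) ∧ z  ≡⟨ cong (_∧ z) (∧-comm x y) ⟩
  (y ∧ x) ∧ z  ≡⟨ ∧-assoc y x z ⟩
  y ∧ (x ∧ z)  ∎
  where open ≡-Reasoning

count-mono : ∀ {n} {p q : Fin n → Bool} → (∀ i → p i ≡ true → q i ≡ true) → count p ≤ count q
count-mono {zero}          h = z≤n
count-mono {suc n} {p} {q} h with p zero in p₀ | q zero in q₀
... | true  | true  = s≤s (count-mono (λ i → h (suc i)))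
... | true  | false = ⊥-elim (false≢true (trans (sym q₀) (h zero p₀)))
... | false | true  = m≤n⇒m≤1+n (count-mono (λ i → h (suc i)))
... | false | false = count-mono (λ i → h (suc i))

count-cong : ∀ {n} {p q : Fin n → Bool} → (∀ i → p i ≡ q i) → count p ≡ count q
count-cong {zero}  h = refl
count-cong {suc n} h = cong₂ _+_ (cong (λ b → if b then 1 else 0) (h zero)) (count-cong (λ i → h (suc i)))

count-≤ : ∀ {n} (p : Fin n → Bool) → count p ≤ n
count-≤ {zero}  p = z≤n
count-≤ {suc n} p with p zero
... | true  = s≤s (count-≤ _)
... | false = m≤n⇒m≤1+n (count-≤ _)

count-pos : ∀ {n} {p : Fin n → Bool} (i : Fin n) → p i ≡ true → 1 ≤ count p
count-pos         zero    h rewrite h = s≤s z≤n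
count-pos {p = p} (suc i) h = ≤-trans (count-pos {p = λ j → p (suc j)} i h) (m≤n+m _ _)

count-split : ∀ {n} (p q : Fin n → Bool) →
  count p ≡ count (λ i → p i ∧ q i) + count (λ i → p i ∧ not (q i))
count-split {zero}  p q = refl
count-split {suc n} p q with p zero | q zero
... | true  | true  = cong suc (count-split (λ i → p (suc i)) (λ i → q (suc i)))
... | true  | false = trans (cong suc (count-split (λ i → p (suc i)) (λ i → q (suc i)))) (sym (+-suc _ _))
... | false | _     = count-split (λ i → p (suc i)) (λ i → q (suc i))

count-∨ : ∀ {n} (p q : Fin n → Bool) → count (λ i → p i ∨ q i) ≤ count p + count q
count-∨ {zero}  p q = z≤n
count-∨ {suc n} p q with p zero | q zero
... | true  | true  = s≤s (≤-trans rest (+-monoʳ-≤ (count (λ i → p (suc i))) (n≤1+n _)))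
  where rest = count-∨ (λ i → p (suc i)) (λ i → q (suc i))
... | true  | false = s≤s (count-∨ (λ i → p (suc i)) (λ i → q (suc i)))
... | false | true  = ≤-trans (s≤s (count-∨ (λ i → p (suc i)) (λ i → q (suc i)))) (≤-reflexive (sym (+-suc _ _)))
... | false | false = count-∨ (λ i → p (suc i)) (λ i → q (suc i))

count-false : ∀ {n} → count {n} (λ _ → false) ≡ 0
count-false {zero}  = refl
count-false {suc n} = count-false {n}

count-point : ∀ {n} (y : Fin n) → count (λ b → does (b ≟ y)) ≡ 1
count-point {suc n} zero    = cong suc (count-false {n})
count-point         (suc y) = count-point y

count-plus-point : ∀ {n} {p q : Fin n → Bool} (y : Fin n) →
  (∀ b → q b ≡ true → p b ≡ true ⊎ b ≡ y) → count q ≤ count p + 1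
count-plus-point {p = p} {q} y h = begin
  count q                                  ≤⟨ count-mono into-union ⟩
  count (λ b → p b ∨ does (b ≟ y))         ≤⟨ count-∨ p _ ⟩
  count p + count (λ b → does (b ≟ y))     ≡⟨ cong (count p +_) (count-point y) ⟩
  count p + 1                              ∎
  where
  open ≤-Reasoning
  into-union : ∀ b → q b ≡ true → (p b ∨ does (b ≟ y)) ≡ true
  into-union b qb with h b qb
  ... | inj₁ pb   = ∨-introˡ _ pb
  ... | inj₂ refl = ∨-introʳ (p b) (dec-true (b ≟ b) refl)

count-weighted : ∀ {n} (c : ℕ) (S : Fin n → Bool) (f : Fin n → ℕ) →
  (∀ a → S a ≡ true → c ≤ f a) → c * count S ≤ sumFin f
count-weighted {zero}  c S f h = ≤-reflexive (*-zeroʳ c)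
count-weighted {suc n} c S f h with S zero in S₀
... | true  = ≤-trans (≤-reflexive (*-suc c _)) (+-mono-≤ (h zero S₀) (count-weighted c _ _ (λ i → h (suc i))))
... | false = ≤-trans (count-weighted c _ _ (λ i → h (suc i))) (m≤n+m _ _)

sum-mono : ∀ {n} {f g : Fin n → ℕ} → (∀ i → f i ≤ g i) → sumFin f ≤ sumFin g
sum-mono {zero}  h = z≤n
sum-mono {suc n} h = +-mono-≤ (h zero) (sum-mono (λ i → h (suc i)))

sum-cong : ∀ {n} {f g : Fin n → ℕ} → (∀ i → f i ≡ g i) → sumFin f ≡ sumFin g
sum-cong {zero}  h = refl
sum-cong {suc n} h = cong₂ _+_ (h zero) (sum-cong (λ i → h (suc i)))

sum-zero : ∀ {n} → sumFin {n} (λ _ → 0) ≡ 0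
sum-zero {zero}  = refl
sum-zero {suc n} = sum-zero {n}

sum-+ : ∀ {n} (f g : Fin n → ℕ) → sumFin (λ i → f i + g i) ≡ sumFin f + sumFin g
sum-+ {zero}  f g = refl
sum-+ {suc n} f g = trans (cong (f zero + g zero +_) (sum-+ (λ i → f (suc i)) (λ i → g (suc i))))
                          (interchange (f zero) (g zero) _ _)
  where
  interchange : ∀ a b c d → (a + b) + (c + d) ≡ (a + c) + (b + d)
  interchange = solve-∀

sum-swap : ∀ {n m} (f : Fin n → Fin m → ℕ) →
  sumFin (λ a → sumFin (λ b → f a b)) ≡ sumFin (λ b → sumFin (λ a → f a b))
sum-swap {zero}  {m} f = sym (sum-zero {m})
sum-swap {suc n}     f = trans (cong (sumFin (f zero) +_) (sum-swap (λ a b → f (suc a) b)))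
                               (sym (sum-+ (f zero) (λ b → sumFin (λ a → f (suc a) b))))

count-as-sum : ∀ {n} (p : Fin n → Bool) → count p ≡ sumFin (λ i → if p i then 1 else 0)
count-as-sum {zero}  p = refl
count-as-sum {suc n} p = cong ((if p zero then 1 else 0) +_) (count-as-sum (λ i → p (suc i)))

count-swap : ∀ {n} (r : Fin n → Fin n → Bool) →
  sumFin (λ a → count (r a)) ≡ sumFin (λ b → count (λ a → r a b))
count-swap r = begin
  sumFin (λ a → count (r a))                                 ≡⟨ sum-cong (λ a → count-as-sum (r a)) ⟩
  sumFin (λ a → sumFin (λ b → if r a b then 1 else 0))       ≡⟨ sum-swap (λ a b → if r a b then 1 else 0) ⟩
  sumFin (λ b → sumFin (λ a → if r a b then 1 else 0))       ≡⟨ sum-cong (λ b → sym (count-as-sum (λ a → r a b))) ⟩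
  sumFin (λ b → count (λ a → r a b))                         ∎
  where open ≡-Reasoning

Adjacent : ∀ {n} → Orientation n → Fin n → Fin n → Bool
Adjacent G a b = G a b ∨ G b a

handshake : ∀ {n} (G : Orientation n) (U : Subset n) →
  sumFin (λ a → count (λ b → U a ∧ (U b ∧ Adjacent G a b))) ≤ inducedEdges G U + inducedEdges G U
handshake G U = begin
  sumFin (λ a → count (λ b → U a ∧ (U b ∧ Adjacent G a b)))  ≡⟨ sum-cong (λ a → count-cong (distribute a)) ⟩
  sumFin (λ a → count (λ b → out a b ∨ into a b))             ≤⟨ sum-mono (λ a → count-∨ (out a) (into a)) ⟩
  sumFin (λ a → count (out a) + count (into a))              ≡⟨ sum-+ (λ a → count (out a)) (λ a → count (into a)) ⟩
  inducedEdges G U + sumFin (λ a → count (into a))           ≡⟨ cong (inducedEdges G U +_) reversed ⟩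
  inducedEdges G U + inducedEdges G U                        ∎
  where
  open ≤-Reasoning
  out into : _ → _ → Bool
  out  a b = U a ∧ (U b ∧ G a b)
  into a b = U a ∧ (U b ∧ G b a)
  distribute : ∀ a b → U a ∧ (U b ∧ Adjacent G a b) ≡ (out a b ∨ into a b)
  distribute a b = trans (cong (U a ∧_) (∧-distribˡ-∨ (U b) _ _)) (∧-distribˡ-∨ (U a) _ _)
  reversed : sumFin (λ a → count (into a)) ≡ inducedEdges G U
  reversed = trans (count-swap into) (sum-cong (λ b → count-cong (λ a → ∧-swap (U a) (U b) (G b a))))

ceilDiv-≤ : ∀ a b α → 1 ≤ b → ceilDiv a b ≤ α → a ≤ α * b
ceilDiv-≤ a (suc b) α _ ceil≤α with a ≤? α * suc b
... | yes a≤ = a≤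
... | no  a≰ = contradiction (≤-trans α<ceil ceil≤α) (n≮n α)
  where
  open ≤-Reasoning
  α<ceil : α < (a + b) / suc b
  α<ceil = begin-strict
    α                          <⟨ n<1+n α ⟩
    suc α                      ≡⟨ sym (m*n/n≡m (suc α) (suc b)) ⟩
    suc α * suc b / suc b      ≤⟨ /-monoˡ-≤ (suc b) (begin
      suc b + α * suc b        ≡⟨ sym (+-suc b (α * suc b)) ⟩
      b + suc (α * suc b)      ≤⟨ +-monoʳ-≤ b (≰⇒> a≰) ⟩
      b + a                    ≡⟨ +-comm b a ⟩
      a + b                    ∎) ⟩
    (a + b) / suc b            ∎

arboricity-edges : ∀ {n} {G : Orientation n} {α} (U : Subset n) →
  ArboricityAtMost G α → 2 ≤ size U → inducedEdges G U ≤ α * (size U ∸ 1)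
arboricity-edges U arb 2≤U = ceilDiv-≤ _ _ _ (∸-monoˡ-≤ 1 2≤U) (arb U 2≤U)

dense-halving : ∀ {n} {G : Orientation n} {α} (U T : Subset n) →
  ArboricityAtMost G α → 1 ≤ α → 2 ≤ size U →
  (∀ a → T a ≡ true → U a ≡ true) →
  (∀ a → T a ≡ true → 4 * α ≤ count (λ b → U b ∧ Adjacent G a b)) →
  2 * size T ≤ size U ∸ 1
dense-halving {G = G} {suc α} U T arb _ 2≤U T⊆U deg =
  *-cancelˡ-≤ (2 * suc α) (begin
    2 * suc α * (2 * size T)                                     ≡⟨ regroup (suc α) (size T) ⟩
    4 * suc α * size T                                          ≤⟨ count-weighted (4 * suc α) T _ lower ⟩
    sumFin (λ a → count (λ b → U a ∧ (U b ∧ Adjacent G a b)))  ≤⟨ handshake G U ⟩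
    inducedEdges G U + inducedEdges G U                         ≤⟨ +-mono-≤ edges edges ⟩
    suc α * (size U ∸ 1) + suc α * (size U ∸ 1)                ≡⟨ double (suc α) (size U ∸ 1) ⟩
    2 * suc α * (size U ∸ 1)                                    ∎)
  where
  open ≤-Reasoning
  regroup : ∀ a t → 2 * a * (2 * t) ≡ 4 * a * t
  regroup = solve-∀
  double : ∀ a m → a * m + a * m ≡ 2 * a * m
  double = solve-∀
  edges : inducedEdges G U ≤ suc α * (size U ∸ 1)
  edges = arboricity-edges U arb 2≤U
  lower : ∀ a → T a ≡ true → 4 * suc α ≤ count (λ b → U a ∧ (U b ∧ Adjacent G a b))
  lower a Ta rewrite T⊆U a Ta = deg a Ta

reset-edge : ∀ {n} (D : Orientation n) u a b →
  reset D u a b ≡ true → D a b ≡ true ⊎ (b ≡ u × D u a ≡ true)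
reset-edge D u a b with a ≟ u
... | yes _ = λ ()
... | no  _ = λ h → flipped (∨-true (D a b) h)
  where
  flipped : D a b ≡ true ⊎ (does (b ≟ u) ∧ D u a) ≡ true → D a b ≡ true ⊎ (b ≡ u × D u a ≡ true)
  flipped (inj₁ kept) = inj₁ kept
  flipped (inj₂ new)  = inj₂ (does-sound (b ≟ u) (∧-conicalˡ _ _ new) , ∧-conicalʳ _ _ new)

outdeg-reset : ∀ {n} (D : Orientation n) u a → outdeg (reset D u) a ≤ outdeg D a + 1
outdeg-reset D u a = count-plus-point u edge
  where
  edge : ∀ b → reset D u a b ≡ true → D a b ≡ true ⊎ b ≡ u
  edge b h with reset-edge D u a b h
  ... | inj₁ kept         = inj₁ kept
  ... | inj₂ (b≡u , _)    = inj₂ b≡u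

reset-adjacent : ∀ {n} (D : Orientation n) u a b →
  Adjacent (reset D u) a b ≡ true → Adjacent D a b ≡ true
reset-adjacent D u a b h with ∨-true (reset D u a b) h
... | inj₁ ab = forward a b ab
  where
  forward : ∀ a b → reset D u a b ≡ true → Adjacent D a b ≡ true
  forward a b ab with reset-edge D u a b ab
  ... | inj₁ kept           = ∨-introˡ _ kept
  ... | inj₂ (refl , ua)    = ∨-introʳ (D a u) ua
... | inj₂ ba with reset-edge D u b a ba
...   | inj₁ kept         = ∨-introʳ (D a b) kept
...   | inj₂ (refl , ub)  = ∨-introˡ _ ub

insert-outdeg : ∀ {n Δ} (D : Orientation n) x y → IsΔOrientation Δ D → ∀ v → outdeg (insertEdge D x y) v ≤ suc Δ
insert-outdeg {Δ = Δ} D x y D-Δ v = ≤-trans (count-plus-point y edge) one-more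
  where
  one-more : outdeg D v + 1 ≤ suc Δ
  one-more = ≤-trans (+-monoˡ-≤ 1 (D-Δ v)) (≤-reflexive (+-comm Δ 1))
  edge : ∀ b → insertEdge D x y v b ≡ true → D v b ≡ true ⊎ b ≡ y
  edge b h with ∨-true (does (v ≟ x) ∧ does (b ≟ y)) h
  ... | inj₁ new = inj₂ (does-sound (b ≟ y) (∧-conicalʳ _ _ new))
  ... | inj₂ old = inj₁ old

insert-loopless : ∀ {n} (D : Orientation n) {x y} → x ≢ y → (∀ a → D a a ≡ false) →
  ∀ a → insertEdge D x y a a ≡ false
insert-loopless D {x} {y} x≢y loopless a with a ≟ x | a ≟ y
... | yes refl | yes refl = contradiction refl x≢y
... | yes _    | no _     = loopless a
... | no _     | _        = loopless a

record Trace {n : ℕ} (Δ : ℕ) (E D : Orientation n) : Set where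
  field
    len       : ℕ
    state     : ℕ → Orientation n
    pivot     : ℕ → Fin n
    start     : state 0 ≡ E
    finish    : state len ≡ D
    steps     : ∀ t → t < len → state (suc t) ≡ reset (state t) (pivot t)
    pivot-max : ∀ t → t < len → ∀ a → Δ < outdeg (state t) a →
                outdeg (state t) a ≤ outdeg (state t) (pivot t)

-- Every cascade has a trace (the vertex only fills unused pivot slots).
trace : ∀ {n Δ} {E D : Orientation n} → Fin n → CascadeReach Δ E D → Trace Δ E D
trace {E = E} v₀ ε = record
  { len = 0 ; state = λ _ → E ; pivot = λ _ → v₀ ; start = refl ; finish = refl
  ; steps = λ _ () ; pivot-max = λ _ () }
trace {n} {Δ} {E} v₀ (step _ v _ v-max ◅ rest) = record
  { len = suc len ; state = state′ ; pivot = pivot′ ; start = refl ; finish = finish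
  ; steps = steps′ ; pivot-max = max′ }
  where
  open Trace (trace v₀ rest)
  state′ : ℕ → Orientation n
  state′ zero    = E
  state′ (suc t) = state t
  pivot′ : ℕ → Fin n
  pivot′ zero    = v
  pivot′ (suc t) = pivot t
  steps′ : ∀ t → t < suc len → state′ (suc t) ≡ reset (state′ t) (pivot′ t)
  steps′ zero    _           = start
  steps′ (suc t) (s≤s t<len) = steps t t<len
  max′ : ∀ t → t < suc len → ∀ a → Δ < outdeg (state′ t) a → outdeg (state′ t) a ≤ outdeg (state′ t) (pivot′ t)
  max′ zero    _           = v-max
  max′ (suc t) (s≤s t<len) = pivot-max t t<len

module Cascade {n Δ} {E D : Orientation n} (τ : Trace Δ E D)
  (E-bound : ∀ v → outdeg E v ≤ suc Δ) where
  open Trace τ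

  outdeg-step : ∀ t → t < len → ∀ v → outdeg (state (suc t)) v ≤ suc (outdeg (state t) v)
  outdeg-step t t<len v rewrite steps t t<len =
    ≤-trans (outdeg-reset (state t) (pivot t) v) (≤-reflexive (+-comm _ 1))

  Quiet : ℕ → ℕ → Set
  Quiet L t = ∀ a → outdeg (state t) a ≤ L

  quiet? : ∀ L t → Dec (Quiet L t)
  quiet? L t = all? (λ a → outdeg (state t) a ≤? L)

  -- runStart L t is the least r ≤ t such that no time in [r, t) is quiet for L.
  runStart : ℕ → ℕ → ℕ
  runStart L zero    = zero
  runStart L (suc t) with quiet? L t
  ... | yes _ = suc t
  ... | no  _ = runStart L t

  runStart-≤ : ∀ L t → runStart L t ≤ t
  runStart-≤ L zero    = z≤n
  runStart-≤ L (suc t) with quiet? L t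
  ... | yes _ = ≤-refl
  ... | no  _ = m≤n⇒m≤1+n (runStart-≤ L t)

  runStart-busy : ∀ L t {u} → runStart L t ≤ u → u < t → ¬ Quiet L u
  runStart-busy L (suc t) r≤u u<t+1 with quiet? L t
  ... | yes _    = contradiction u<t+1 (≤⇒≯ r≤u)
  ... | no  busy with m≤n⇒m<n∨m≡n (≤-pred u<t+1)
  ...   | inj₁ u<t = runStart-busy L t r≤u u<t
  ...   | inj₂ refl = busy

  -- At the start of a run every outdegree is at most L + 1: either it is
  -- time 0, or the previous time was quiet and one reset followed.
  runStart-calm : ∀ {L} → Δ ≤ L → ∀ t → t ≤ len → Quiet (suc L) (runStart L t)
  runStart-calm {L} Δ≤L zero    _ a =
    subst (λ F → outdeg F a ≤ suc L) (sym start) (≤-trans (E-bound a) (s≤s Δ≤L))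
  runStart-calm {L} Δ≤L (suc t) t<len with quiet? L t
  ... | yes quiet = λ a → ≤-trans (outdeg-step t t<len a) (s≤s (quiet a))
  ... | no  _     = runStart-calm Δ≤L t (<⇒≤ t<len)

  -- A higher level is quiet more often, so its run starts later.
  runStart-mono : ∀ {L′ L} → L′ ≤ L → ∀ t → runStart L′ t ≤ runStart L t
  runStart-mono L′≤L zero = z≤n
  runStart-mono {L′} {L} L′≤L (suc t) with quiet? L′ t | quiet? L t
  ... | yes _      | yes _    = ≤-refl
  ... | yes quiet′ | no  busy = contradiction (λ a → ≤-trans (quiet′ a) L′≤L) busy
  ... | no  _      | yes _    = m≤n⇒m≤1+n (runStart-≤ L′ t)
  ... | no  _      | no  _    = runStart-mono L′≤L t

  onset : ℕ → ℕ
  onset L = runStart L len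

  active? : ∀ L v → Dec (∃ λ s → s < suc len × (onset L ≤ s × L < outdeg (state s) v))
  active? L v = anyUpTo? (λ s → onset L ≤? s ×-dec L <? outdeg (state s) v) (suc len)

  Active : ℕ → Subset n
  Active L v = does (active? L v)

  active-intro : ∀ {L v s} → onset L ≤ s → s ≤ len → L < outdeg (state s) v → Active L v ≡ true
  active-intro r≤s s≤len over = dec-true (active? _ _) (_ , s≤s s≤len , r≤s , over)

  active-mono : ∀ {L′ L} v → L′ ≤ L → Active L v ≡ true → Active L′ v ≡ true
  active-mono v L′≤L h with does-sound (active? _ v) h
  ... | s , s≤len , r≤s , over =
    active-intro (≤-trans (runStart-mono L′≤L len) r≤s) (≤-pred s≤len) (≤-<-trans L′≤L over)

  final-active : ∀ {L} u → L < outdeg D u → Active L u ≡ true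
  final-active u over = active-intro (runStart-≤ _ len) ≤-refl (subst (λ F → _ < outdeg F u) (sym finish) over)

  pivot-active : ∀ {L t} → Δ ≤ L → onset L ≤ t → t < len → Active L (pivot t) ≡ true
  pivot-active {L} {t} Δ≤L r≤t t<len
    with ¬∀⟶∃¬ n _ (λ a → outdeg (state t) a ≤? L) (runStart-busy L len r≤t t<len)
  ... | a , a≰L = active-intro r≤t (<⇒≤ t<len) (<-≤-trans L<a (pivot-max t t<len a (≤-<-trans Δ≤L L<a)))
    where
    L<a : L < outdeg (state t) a
    L<a = ≰⇒> a≰L

  edge-persists : ∀ {r s v z} → r ≤ s → s ≤ len → (∀ t → r ≤ t → t < s → pivot t ≢ z) →
    state s v z ≡ true → state r v z ≡ true
  edge-persists {s = zero} z≤n _ _ h = h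
  edge-persists {r} {suc s} {v} {z} r≤s+1 s<len never h with m≤n⇒m<n∨m≡n r≤s+1
  ... | inj₂ refl       = h
  ... | inj₁ (s≤s r≤s) =
    edge-persists r≤s (<⇒≤ s<len) (λ t r≤t t<s → never t r≤t (m≤n⇒m≤1+n t<s)) earlier
    where
    earlier : state s v z ≡ true
    earlier with reset-edge (state s) (pivot s) v z (subst (λ F → F v z ≡ true) (steps s s<len) h)
    ... | inj₁ kept      = kept
    ... | inj₂ (z≡p , _) = contradiction (sym z≡p) (never s r≤s (n<1+n s))

  adjacent-origin : ∀ {t a b} → t ≤ len → Adjacent (state t) a b ≡ true → Adjacent E a b ≡ true
  adjacent-origin {zero}  {a} {b} _     h = subst (λ F → Adjacent F a b ≡ true) start h
  adjacent-origin {suc t} {a} {b} t<len h =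
    adjacent-origin (<⇒≤ t<len)
      (reset-adjacent (state t) (pivot t) a b (subst (λ F → Adjacent F a b ≡ true) (steps t t<len) h))

  -- After the onset of L ≥ Δ, an outdegree exceeds L + 1 by at most the
  -- number of L-active neighbours: edges towards inactive vertices date
  -- back to the onset, when there were at most L + 1 of them.
  outdeg-after-onset : ∀ {L s} v → Δ ≤ L → onset L ≤ s → s ≤ len →
    outdeg (state s) v ≤ suc L + count (λ z → Active L z ∧ Adjacent E v z)
  outdeg-after-onset {L} {s} v Δ≤L r≤s s≤len = begin
    outdeg (state s) v
      ≡⟨ count-split (state s v) (Active L) ⟩
    count (λ z → state s v z ∧ Active L z) + count (λ z → state s v z ∧ not (Active L z))
      ≤⟨ +-mono-≤ (count-mono towards-active) (count-mono towards-inactive) ⟩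
    count (λ z → Active L z ∧ Adjacent E v z) + outdeg (state (onset L)) v
      ≤⟨ +-monoʳ-≤ _ (runStart-calm Δ≤L len ≤-refl v) ⟩
    count (λ z → Active L z ∧ Adjacent E v z) + suc L
      ≡⟨ +-comm _ (suc L) ⟩
    suc L + count (λ z → Active L z ∧ Adjacent E v z)
      ∎
    where
    open ≤-Reasoning
    towards-active : ∀ z → (state s v z ∧ Active L z) ≡ true → (Active L z ∧ Adjacent E v z) ≡ true
    towards-active z h =
      ∧-intro (∧-conicalʳ (state s v z) _ h)
              (adjacent-origin s≤len (∨-introˡ (state s z v) (∧-conicalˡ _ (Active L z) h)))
    towards-inactive : ∀ z → (state s v z ∧ not (Active L z)) ≡ true → state (onset L) v z ≡ true
    towards-inactive z h = edge-persists r≤s s≤len never (∧-conicalˡ _ _ h)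
      where
      never : ∀ t → onset L ≤ t → t < s → pivot t ≢ z
      never t r≤t t<s refl =
        false≢true (trans (sym (cong not (pivot-active Δ≤L r≤t (<-≤-trans t<s s≤len)))) (∧-conicalʳ _ _ h))

  active-neighbours : ∀ {L} d v → Δ ≤ L → Active (L + d) v ≡ true →
    d ≤ count (λ z → Active L z ∧ Adjacent E v z)
  active-neighbours {L} d v Δ≤L h with does-sound (active? (L + d) v) h
  ... | s , s≤len , r≤s , over = +-cancelˡ-≤ L d _ (≤-pred (≤-trans over
          (outdeg-after-onset v Δ≤L (≤-trans (runStart-mono (m≤m+n L d) len) r≤s) (≤-pred s≤len))))

  -- In a loopless graph such a vertex and its neighbours give d + 1 L-active vertices.
  active-count : ∀ {L} d w → (∀ a → E a a ≡ false) → Δ ≤ L → Active (L + d) w ≡ true →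
    suc d ≤ size (Active L)
  active-count {L} d w loopless Δ≤L h = begin
    suc d
      ≡⟨ +-comm 1 d ⟩
    d + 1
      ≤⟨ +-mono-≤ (active-neighbours d w Δ≤L h) (count-pos w (∧-intro (active-mono w (m≤m+n L d) h) not-self)) ⟩
    count (λ z → Active L z ∧ Adjacent E w z) + count (λ z → Active L z ∧ not (Adjacent E w z))
      ≡⟨ sym (count-split (Active L) (Adjacent E w)) ⟩
    size (Active L)
      ∎
    where
    open ≤-Reasoning
    not-self : not (Adjacent E w w) ≡ true
    not-self rewrite loopless w = refl

  module Levels {α} (arb : ArboricityAtMost E α) (1≤α : 1 ≤ α) (loopless : ∀ a → E a a ≡ false) where

    active-halving : ∀ {L} → Δ ≤ L → 2 ≤ size (Active L) →
      2 * size (Active (L + 4 * α)) ≤ size (Active L) ∸ 1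
    active-halving {L} Δ≤L 2≤A =
      dense-halving (Active L) (Active (L + 4 * α)) arb 1≤α 2≤A
        (λ a → active-mono a (m≤m+n L (4 * α))) (λ a → active-neighbours (4 * α) a Δ≤L)

    active-growth : ∀ j {L} w → Δ ≤ L → Active (L + 4 * α * suc j) w ≡ true →
      α * 2 ^ suc j < size (Active L)
    active-growth zero {L} w Δ≤L h = begin-strict
      α * 2     ≡⟨ *-comm α 2 ⟩
      2 * α     ≤⟨ *-monoˡ-≤ α {2} {4} (s≤s (s≤s z≤n)) ⟩
      4 * α     <⟨ active-count (4 * α) w loopless Δ≤L level ⟩
      size (Active L) ∎
      where
      open ≤-Reasoning
      level : Active (L + 4 * α) w ≡ true
      level = subst (λ m → Active (L + m) w ≡ true) (*-identityʳ (4 * α)) h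
    active-growth (suc j) {L} w Δ≤L h = begin-strict
      α * 2 ^ suc (suc j)            ≡⟨ swap-factor α (2 ^ suc j) ⟩
      2 * (α * 2 ^ suc j)            <⟨ *-monoʳ-< 2 (active-growth j w (≤-trans Δ≤L (m≤m+n L _)) higher) ⟩
      2 * size (Active (L + 4 * α))  ≤⟨ active-halving Δ≤L 2≤A ⟩
      size (Active L) ∸ 1            ≤⟨ m∸n≤m _ 1 ⟩
      size (Active L)                ∎
      where
      open ≤-Reasoning
      swap-factor : ∀ a x → a * (2 * x) ≡ 2 * (a * x)
      swap-factor = solve-∀
      shift : ∀ L a j → L + 4 * a * (2 + j) ≡ (L + 4 * a) + 4 * a * (1 + j)
      shift = solve-∀
      higher : Active ((L + 4 * α) + 4 * α * suc j) w ≡ true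
      higher = subst (λ m → Active m w ≡ true) (shift L α j) h
      2≤A : 2 ≤ size (Active L)
      2≤A = ≤-trans (s≤s (≤-trans 1≤α (m≤n*m α 4)))
                    (active-count (4 * α) w loopless Δ≤L
                       (active-mono w (+-monoʳ-≤ L (m≤m*n (4 * α) (suc (suc j)))) h))

-- With α ≥ 1 and n ≤ α·2^(j+1): an outdegree above 4α(j+1) + Δ would make
-- more than α·2^(j+1) ≥ n vertices Δ-active.
cascade-bound : ∀ {n α Δ} j → 1 ≤ α → n ≤ α * 2 ^ suc j →
  (D₀ : Orientation n) → (∀ a → D₀ a a ≡ false) → IsΔOrientation Δ D₀ →
  (x y : Fin n) → x ≢ y → ArboricityAtMost (insertEdge D₀ x y) α →
  (D : Orientation n) → CascadeReach Δ (insertEdge D₀ x y) D →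
  ∀ u → outdeg D u ≤ 4 * α * suc j + Δ
cascade-bound {n} {α} {Δ} j 1≤α n≤ D₀ loopless D₀-Δ x y x≢y arb D reach u
  with outdeg D u ≤? 4 * α * suc j + Δ
... | yes bounded = bounded
... | no  too-big = contradiction (begin-strict
      α * 2 ^ suc j       <⟨ active-growth j u ≤-refl u-active ⟩
      size (Active Δ)     ≤⟨ count-≤ (Active Δ) ⟩
      n                   ≤⟨ n≤ ⟩
      α * 2 ^ suc j       ∎) (n≮n _)
  where
  open ≤-Reasoning
  open Cascade (trace x reach) (insert-outdeg D₀ x y D₀-Δ)
  open Levels arb 1≤α (insert-loopless D₀ x≢y loopless)
  u-active : Active (Δ + 4 * α * suc j) u ≡ true
  u-active = final-active u (subst (_< outdeg D u) (+-comm _ Δ) (≰⇒> too-big))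

-- α ≥ 1 and k ≥ 1 follow from α < n ≤ α·2^k.
lemma4 : (n α Δ k : ℕ) → α < n → IsCeilLog2Ratio n α k →
    (D₀ : Orientation n) → WellFormed D₀ → IsΔOrientation Δ D₀ →
    (x y : Fin n) → x ≢ y → D₀ x y ≡ false → D₀ y x ≡ false →
    ArboricityAtMost (insertEdge D₀ x y) α →
    (D : Orientation n) → CascadeReach Δ (insertEdge D₀ x y) D →
    (u : Fin n) → outdeg D u ≤ 4 * α * k + Δ
lemma4 n zero Δ k 0<n (n≤0 , _) _ _ _ _ _ _ _ _ _ _ _ _ =
  contradiction (<-≤-trans 0<n n≤0) (n≮n 0)
lemma4 n (suc α) Δ zero α<n (n≤α , _) _ _ _ _ _ _ _ _ _ _ _ _ =
  contradiction (<-≤-trans α<n (≤-trans n≤α (≤-reflexive (*-identityʳ (suc α))))) (n≮n _)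
lemma4 n (suc α) Δ (suc j) _ (n≤ , _) D₀ (loopless , _) D₀-Δ x y x≢y _ _ arb D reach u =
  cascade-bound j (s≤s z≤n) n≤ D₀ loopless D₀-Δ x y x≢y arb D reach u
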